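{- Let $Ag$ be a finite set of agents and $\mathcal{CS}$ a constant specification. Let $\xi$ be an element and $A\in Form^{Ag}$. Then: (1) $A\in\bigcap_{\tau\equiv\xi}end(\tau)$ iff $\Box A\in end(\xi)$ iff $\Box A\in\bigcap_{\tau\equiv\xi}end(\tau)$, where $\tau$ ranges over elements; (2) if $\vdash_{\mathcal{CS}}A\to\Box A$, then $A\in end(\xi)$ iff $A\in\bigcap_{\tau\equiv\xi}end(\tau)$ iff $\Box A\in\bigcap_{\tau\equiv\xi}end(\tau)$.
   Context: Language: finite $Ag$; countably infinite $PVar$, $PConst$, $Var$; $Pol$: $t ::= x\mid c\mid s+t\mid s\times t\mid\ !t$; $Form^{Ag}$: $A ::= p\mid A\wedge B\mid\neg A\mid[j]A\mid\Box A\mid t{:}A\mid KA\mid Prove(j,t,A)\mid Proven(t,A)$; $\Diamond$, $\langle j\rangle$ duals. System $\Pi$: axiom schemes (A0) propositional tautologies; (A1) S5 for $\Box$ and each $[j]$; (A2) $\Box A\to[j]A$; (A3) $(\Diamond[j_1]A_1\wedge\dots\wedge\Diamond[j_n]A_n)\to\Diamond([j_1]A_1\wedge\dots\wedge[j_n]A_n)$, $j_k$ pairwise distinct; (A4) $s{:}(A\to B)\to(t{:}A\to(s\times t){:}B)$; (A5) $t{:}A\to(!t{:}(t{:}A)\wedge KA)$; (A6) $(s{:}A\vee t{:}A)\to(s+t){:}A$; (A7) S4 for $K$; (A8) $KA\to\Box K\Box A$; (B9) $Prove(j,t,A)\to(\neg Proven(t,A)\wedge[j]Prove(j,t,A)\wedge\neg\Box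 Prove(j,t,A)\wedge t{:}A)$; (B10) $(Prove(j,t,A)\wedge t{:}B)\to Prove(j,t,B)$; (B11) $Proven(t,A)\to(KProven(t,A)\wedge t{:}A)$; (B12) $(Proven(t,A)\wedge t{:}B)\to Proven(t,B)$; (B13) $\neg Prove(j,t,A)\to\langle j\rangle\bigwedge_{i\in Ag}\neg Prove(i,t,A)$. Rules: modus ponens; from $A$ infer $KA$; (S4) from $KA\to(\neg Proven(t_1,B_1)\vee\dots\vee\neg Proven(t_n,B_n))$ infer $KA\to(\bigwedge_{j\in Ag}\neg Prove(j,t_1,B_1)\vee\dots\vee\bigwedge_{j\in Ag}\neg Prove(j,t_n,B_n))$. Constant specification $\mathcal{CS}$: set of formulas $c_n{:}\dots c_1{:}A$ ($A$ an axiom instance) closed under removing the outer constant; $\Pi(\mathcal{CS})$ adds the rule inferring members of $\mathcal{CS}$; $\vdash_{\mathcal{CS}}$ is provability in $\Pi(\mathcal{CS})$; $\mathcal{CS}$-consistency and maxiconsistency defined as usual. An element is a sequence $(\Gamma_1,\dots,\Gamma_m)$, $m\geq1$, of $\mathcal{CS}$-maxiconsistent sets such that for $k<m$: $KA\in\Gamma_k\Rightarrow KA\in\Gamma_{k+1}$, and $Prove(j,t,A)\in\Gamma_k\Rightarrow Proven(t,A)\in\Gamma_{k+1}$. Its end $end((\Gamma_1,\dots,\Gamma_m))=\Gamma_m$. For elements of equal length: $(\Gamma_1,\dots,\Gamma_n,\Gamma_{n+1})\equiv(\Delta_1,\dots,\Delta_n,\Delta_{n+1})$ iff $\Gamma_k=\Delta_k$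 for $k\leq n$ and $\Box A\in\Gamma_{n+1}$ implies $A\in\Delta_{n+1}$ for all $A$. -}

module Defs where

open import Data.Nat using (ℕ; zero; suc)
open import Data.Bool using (Bool; true; false; not; _∧_)
open import Data.Fin using (Fin; inject₁; fromℕ)
open import Data.List using (List; []; _∷_; map; allFin)
open import Data.List.NonEmpty using (List⁺; _∷_; toList)
  renaming (map to map⁺)
open import Data.List.Relation.Unary.All using (All)
open import Data.List.Relation.Unary.Unique.Propositional using (Unique)
open import Data.Product using (Σ; _×_; _,_; proj₁; proj₂)
open import Data.Empty using (⊥)
open import Relation.Nullary using (¬_)
open import Relation.Binary.PropositionalEquality using (_≡_)
open import Function.Bundles using (_⇔_)
open import Level using () renaming (suc to lsuc; zero to lzero)

PVar PConst Var : Set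
PVar = ℕ
PConst = ℕ
Var = ℕ

data Pol : Set where
  var   : Var → Pol
  const : PConst → Pol
  _⊕_   : Pol → Pol → Pol
  _⊗_   : Pol → Pol → Pol
  !_    : Pol → Pol

data Form (n : ℕ) : Set where
  atom   : PVar → Form n
  _&_    : Form n → Form n → Form n
  ~_     : Form n → Form n
  [_]_   : Fin n → Form n → Form n
  □_     : Form n → Form n
  _∶_    : Pol → Form n → Form n
  K_     : Form n → Form n
  Prove  : Fin n → Pol → Form n → Form n
  Proven : Pol → Form n → Form n

infixr 6 _&_
infix 8 ~_ □_ K_ [_]_ _∶_

module _ {n : ℕ} where

  infixr 5 _∨'_
  infixr 4 _⇒_
  infix 8 ◇_ ⟨_⟩_
  infix 2 _⊢_

  _⇒_ : Form n → Form n → Form n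
  A ⇒ B = ~ (A & ~ B)

  _∨'_ : Form n → Form n → Form n
  A ∨' B = ~ (~ A & ~ B)

  ◇_ : Form n → Form n
  ◇ A = ~ □ ~ A

  ⟨_⟩_ : Fin n → Form n → Form n
  ⟨ j ⟩ A = ~ [ j ] ~ A

  ⊤' : Form n
  ⊤' = ~ (atom 0 & ~ atom 0)

  ⋀ : List (Form n) → Form n
  ⋀ []           = ⊤'
  ⋀ (A ∷ [])     = A
  ⋀ (A ∷ B ∷ As) = A & ⋀ (B ∷ As)

  ⋁ˡ : Form n → List (Form n) → Form n
  ⋁ˡ A []       = A
  ⋁ˡ A (B ∷ As) = A ∨' ⋁ˡ B As

  ⋁⁺ : List⁺ (Form n) → Form n
  ⋁⁺ (A ∷ As) = ⋁ˡ A As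

  ⋀⁺ : List⁺ (Form n) → Form n
  ⋀⁺ As = ⋀ (toList As)

  noneProve : Pol → Form n → Form n
  noneProve t A = ⋀ (map (λ i → ~ Prove i t A) (allFin n))

  -- Propositional tautologies: true under every Boolean assignment to
  -- the non-Boolean (maximal non-propositional) subformulas.

  eval : (Form n → Bool) → Form n → Bool
  eval v (A & B) = eval v A ∧ eval v B
  eval v (~ A)   = not (eval v A)
  eval v A       = v A

  Tautology : Form n → Set
  Tautology A = (v : Form n → Bool) → eval v A ≡ true

  data Axiom : Form n → Set where
    A0    : ∀ {A} → Tautology A → Axiom A
    A1-□K : ∀ {A B} → Axiom (□ (A ⇒ B) ⇒ (□ A ⇒ □ B))
    A1-□T : ∀ {A} → Axiom (□ A ⇒ A)
    A1-□5 : ∀ {A} → Axiom (◇ A ⇒ □ ◇ A)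
    A1-jK : ∀ {j A B} → Axiom ([ j ] (A ⇒ B) ⇒ ([ j ] A ⇒ [ j ] B))
    A1-jT : ∀ {j A} → Axiom ([ j ] A ⇒ A)
    A1-j5 : ∀ {j A} → Axiom (⟨ j ⟩ A ⇒ [ j ] ⟨ j ⟩ A)
    A2    : ∀ {j A} → Axiom (□ A ⇒ [ j ] A)
    A3    : (js : List⁺ (Fin n × Form n)) →
            Unique (toList (map⁺ proj₁ js)) →
            Axiom (⋀⁺ (map⁺ (λ p → ◇ [ proj₁ p ] proj₂ p) js)
                   ⇒ ◇ ⋀⁺ (map⁺ (λ p → [ proj₁ p ] proj₂ p) js))
    A4    : ∀ {s t A B} → Axiom ((s ∶ (A ⇒ B)) ⇒ ((t ∶ A) ⇒ ((s ⊗ t) ∶ B)))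
    A5    : ∀ {t A} → Axiom ((t ∶ A) ⇒ ((! t) ∶ (t ∶ A) & K A))
    A6    : ∀ {s t A} → Axiom (((s ∶ A) ∨' (t ∶ A)) ⇒ ((s ⊕ t) ∶ A))
    A7-K  : ∀ {A B} → Axiom (K (A ⇒ B) ⇒ (K A ⇒ K B))
    A7-T  : ∀ {A} → Axiom (K A ⇒ A)
    A7-4  : ∀ {A} → Axiom (K A ⇒ K K A)
    A8    : ∀ {A} → Axiom (K A ⇒ □ K □ A)
    B9    : ∀ {j t A} → Axiom (Prove j t A ⇒
              (~ Proven t A & [ j ] Prove j t A & ~ □ Prove j t A & (t ∶ A)))
    B10   : ∀ {j t A B} → Axiom ((Prove j t A & (t ∶ B)) ⇒ Prove j t B)
    B11   : ∀ {t A} → Axiom (Proven t A ⇒ (K Proven t A & (t ∶ A)))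
    B12   : ∀ {t A B} → Axiom ((Proven t A & (t ∶ B)) ⇒ Proven t B)
    B13   : ∀ {j t A} → Axiom (~ Prove j t A ⇒ ⟨ j ⟩ noneProve t A)

  wrap : List PConst → Form n → Form n
  wrap []       A = A
  wrap (c ∷ cs) A = const c ∶ wrap cs A

  record IsCS (CS : Form n → Set) : Set where
    field
      shape   : ∀ F → CS F →
                Σ PConst λ c → Σ (List PConst) λ cs → Σ (Form n) λ A →
                  Axiom A × (F ≡ wrap (c ∷ cs) A)
      closure : ∀ c c' cs A → Axiom A →
                CS (wrap (c ∷ c' ∷ cs) A) → CS (wrap (c' ∷ cs) A)

  data _⊢_ (CS : Form n → Set) : Form n → Set where
    ax  : ∀ {A} → Axiom A → CS ⊢ A
    cs  : ∀ {A} → CS A → CS ⊢ A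
    mp  : ∀ {A B} → CS ⊢ (A ⇒ B) → CS ⊢ A → CS ⊢ B
    nec : ∀ {A} → CS ⊢ A → CS ⊢ K A
    S4  : ∀ {A} (ps : List⁺ (Pol × Form n)) →
          CS ⊢ (K A ⇒ ⋁⁺ (map⁺ (λ p → ~ Proven (proj₁ p) (proj₂ p)) ps)) →
          CS ⊢ (K A ⇒ ⋁⁺ (map⁺ (λ p → noneProve (proj₁ p) (proj₂ p)) ps))

  Consistent : (Form n → Set) → (Form n → Set) → Set
  Consistent CS Γ = ¬ (Σ (List (Form n)) λ L → All Γ L × (CS ⊢ ~ ⋀ L))

  _∪｛_｝ : (Form n → Set) → Form n → (Form n → Set)
  (Γ ∪｛ A ｝) B = Γ B ⊎' (B ≡ A)
    where
      open import Data.Sum using () renaming (_⊎_ to _⊎'_)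

  Maxiconsistent : (Form n → Set) → (Form n → Set) → Set
  Maxiconsistent CS Γ = Consistent CS Γ × (∀ A → Consistent CS (Γ ∪｛ A ｝) → Γ A)

  record Element (CS : Form n → Set) (m : ℕ) : Set₁ where
    field
      seq   : Fin (suc m) → Form n → Set
      mcs   : ∀ k → Maxiconsistent CS (seq k)
      K-up  : ∀ (k : Fin m) A → seq (inject₁ k) (K A) → seq (Fin.suc k) (K A)
      P-up  : ∀ (k : Fin m) j t A →
              seq (inject₁ k) (Prove j t A) → seq (Fin.suc k) (Proven t A)

  end : ∀ {CS m} → Element CS m → Form n → Set
  end {m = m} ξ = Element.seq ξ (fromℕ m)

  _≡ₑ_ : ∀ {CS m} → Element CS m → Element CS m → Set
  _≡ₑ_ {m = m} τ ξ =
    (∀ (k : Fin m) A → (Element.seq τ (inject₁ k) A ⇔ Element.seq ξ (inject₁ k) A)) ×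
    (∀ A → end τ (□ A) → end ξ A)

  ⋂end : ∀ {CS m} → Element CS m → Form n → Set₁
  ⋂end {CS} {m} ξ A = (τ : Element CS m) → τ ≡ₑ ξ → end τ A

module Submission where

-- The relation
-- τ ≡ ξ only constrains the last set through the S5 accessibility
-- "Sees Γ Δ : □C ∈ Γ ⇒ C ∈ Δ", so everything reduces to the canonical
-- model argument for □:
--   * □A ∈ end ξ puts A and □A into every accessible end (axioms T, 5);
--   * conversely, if □A ∉ end ξ then {C | □C ∈ end ξ} ∪ {¬A} is consistent,
--     Lindenbaum extends it to a maxiconsistent Δ, and replacing the last
--     set of ξ by Δ is again an element (K- and Proven-formulas are
--     □-stable, by A7, A8, B11), equivalent to ξ and with A ∉ end.

open import Defs
open import Data.Nat using (ℕ; zero; suc; _+_; _≤_; _⊔_; s≤s; _≤′_; ≤′-refl; ≤′-step)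
open import Data.Nat.Properties
  using (+-suc; +-identityʳ; suc-injective; m⊔n≤o⇒m≤o; m⊔n≤o⇒n≤o; ≤-refl; m≤m⊔n; m≤n⊔m; ≤⇒≤′)
open import Data.Bool using (Bool; true; false; not; _∧_)
open import Data.Bool.Properties using (not-¬; ¬-not)
open import Data.Maybe using (Maybe; just; nothing; maybe′)
import Data.Maybe as Maybe
open import Data.Fin using (Fin; toℕ; inject₁; fromℕ; zero; suc)
open import Data.Fin.Properties using (fromℕ≢inject₁)
open import Data.List using (List; []; _∷_; _++_; map)
open import Data.List.Relation.Unary.All as All using (All; []; _∷_)
open import Data.List.Relation.Unary.All.Properties using (++⁺; ++⁻ˡ; ++⁻ʳ; map⁺)
open import Data.Product using (Σ; ∃; _×_; _,_; proj₁; proj₂; uncurry)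
open import Data.Sum using (_⊎_; inj₁; inj₂)
open import Data.Empty using (⊥; ⊥-elim)
open import Relation.Nullary using (¬_)
open import Relation.Binary.PropositionalEquality hiding ([_])
open import Function.Bundles using (_⇔_; mk⇔)
open import Function using (id)

next : ℕ × ℕ → ℕ × ℕ
next (a , zero)  = 0 , suc a
next (a , suc b) = suc a , b

unpair : ℕ → ℕ × ℕ
unpair zero    = 0 , 0
unpair (suc k) = next (unpair k)

unpair-onto : ∀ s a b → a + b ≡ s → ∃ λ k → unpair k ≡ (a , b)
unpair-onto s       zero    zero    _  = 0 , refl
unpair-onto s       (suc a) b       eq =
  let k , e = unpair-onto s a (suc b) (trans (+-suc a b) eq) in suc k , cong next e
unpair-onto zero    zero    (suc b) ()
unpair-onto (suc s) zero    (suc b) eq =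
  let k , e = unpair-onto s b zero (trans (+-identityʳ b) (suc-injective eq))
  in suc k , cong next e

pair : ℕ → ℕ → ℕ
pair a b = proj₁ (unpair-onto (a + b) a b refl)

unpair-pair : ∀ a b → unpair (pair a b) ≡ (a , b)
unpair-pair a b = proj₂ (unpair-onto (a + b) a b refl)

split₂ : {R : Set} → (ℕ → ℕ → R) → ℕ → R
split₂ g c = uncurry g (unpair c)

-- Decoding of polynomials with a recursion depth ("fuel") f; a code is a
-- pair (constructor tag, payload).
decodePol : ℕ → ℕ → Pol
decodePol zero    _ = var 0
decodePol (suc f) c = split₂ node c
  where
  node : ℕ → ℕ → Pol
  node 0 x = var x
  node 1 x = const x
  node 2 x = split₂ (λ a b → decodePol f a ⊕ decodePol f b) x
  node 3 x = split₂ (λ a b → decodePol f a ⊗ decodePol f b) x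
  node 4 x = ! decodePol f x
  node _ _ = var 0

codePol : Pol → ℕ
codePol (var x)   = pair 0 x
codePol (const c) = pair 1 c
codePol (s ⊕ t)   = pair 2 (pair (codePol s) (codePol t))
codePol (s ⊗ t)   = pair 3 (pair (codePol s) (codePol t))
codePol (! t)     = pair 4 (codePol t)

depthPol : Pol → ℕ
depthPol (s ⊕ t) = suc (depthPol s ⊔ depthPol t)
depthPol (s ⊗ t) = suc (depthPol s ⊔ depthPol t)
depthPol (! t)   = suc (depthPol t)
depthPol _       = 1

decodePol-codePol : ∀ t {f} → depthPol t ≤ f → decodePol f (codePol t) ≡ t
decodePol-codePol (var x)   (s≤s _) rewrite unpair-pair 0 x = refl
decodePol-codePol (const c) (s≤s _) rewrite unpair-pair 1 c = refl
decodePol-codePol (s ⊕ t) (s≤s le)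
  rewrite unpair-pair 2 (pair (codePol s) (codePol t)) | unpair-pair (codePol s) (codePol t)
  = cong₂ _⊕_ (decodePol-codePol s (m⊔n≤o⇒m≤o _ _ le)) (decodePol-codePol t (m⊔n≤o⇒n≤o _ _ le))
decodePol-codePol (s ⊗ t) (s≤s le)
  rewrite unpair-pair 3 (pair (codePol s) (codePol t)) | unpair-pair (codePol s) (codePol t)
  = cong₂ _⊗_ (decodePol-codePol s (m⊔n≤o⇒m≤o _ _ le)) (decodePol-codePol t (m⊔n≤o⇒n≤o _ _ le))
decodePol-codePol (! t) (s≤s le) rewrite unpair-pair 4 (codePol t) = cong !_ (decodePol-codePol t le)

finOf : (n : ℕ) → ℕ → Maybe (Fin n)
finOf zero    _       = nothing
finOf (suc n) zero    = just zero
finOf (suc n) (suc i) = Maybe.map suc (finOf n i)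

finOf-toℕ : ∀ {n} (j : Fin n) → finOf n (toℕ j) ≡ just j
finOf-toℕ zero    = refl
finOf-toℕ (suc j) = cong (Maybe.map suc) (finOf-toℕ j)

module _ {n : ℕ} where

  withAgent : ℕ → (Fin n → Form n) → Form n
  withAgent i k = maybe′ k ⊤' (finOf n i)

  decodeForm : ℕ → ℕ → Form n
  decodeForm zero    _ = ⊤'
  decodeForm (suc f) c = split₂ node c
    where
    node : ℕ → ℕ → Form n
    node 0 p = atom p
    node 1 x = split₂ (λ a b → decodeForm f a & decodeForm f b) x
    node 2 x = ~ decodeForm f x
    node 3 x = split₂ (λ i a → withAgent i (λ j → [ j ] decodeForm f a)) x
    node 4 x = □ decodeForm f x
    node 5 x = split₂ (λ t a → decodePol f t ∶ decodeForm f a) x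
    node 6 x = K decodeForm f x
    node 7 x = split₂ (λ i y → withAgent i (λ j →
                 split₂ (λ t a → Prove j (decodePol f t) (decodeForm f a)) y)) x
    node 8 x = split₂ (λ t a → Proven (decodePol f t) (decodeForm f a)) x
    node _ _ = ⊤'

  codeForm : Form n → ℕ
  codeForm (atom p)      = pair 0 p
  codeForm (A & B)       = pair 1 (pair (codeForm A) (codeForm B))
  codeForm (~ A)         = pair 2 (codeForm A)
  codeForm ([ j ] A)     = pair 3 (pair (toℕ j) (codeForm A))
  codeForm (□ A)         = pair 4 (codeForm A)
  codeForm (t ∶ A)       = pair 5 (pair (codePol t) (codeForm A))
  codeForm (K A)         = pair 6 (codeForm A)
  codeForm (Prove j t A) = pair 7 (pair (toℕ j) (pair (codePol t) (codeForm A)))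
  codeForm (Proven t A)  = pair 8 (pair (codePol t) (codeForm A))

  depth : Form n → ℕ
  depth (atom _)      = 1
  depth (A & B)       = suc (depth A ⊔ depth B)
  depth (~ A)         = suc (depth A)
  depth ([ _ ] A)     = suc (depth A)
  depth (□ A)         = suc (depth A)
  depth (t ∶ A)       = suc (depthPol t ⊔ depth A)
  depth (K A)         = suc (depth A)
  depth (Prove _ t A) = suc (depthPol t ⊔ depth A)
  depth (Proven t A)  = suc (depthPol t ⊔ depth A)

  decodeForm-codeForm : ∀ A {f} → depth A ≤ f → decodeForm f (codeForm A) ≡ A
  decodeForm-codeForm (atom p) (s≤s _) rewrite unpair-pair 0 p = refl
  decodeForm-codeForm (A & B) (s≤s le)
    rewrite unpair-pair 1 (pair (codeForm A) (codeForm B)) | unpair-pair (codeForm A) (codeForm B)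
    = cong₂ _&_ (decodeForm-codeForm A (m⊔n≤o⇒m≤o _ _ le)) (decodeForm-codeForm B (m⊔n≤o⇒n≤o _ _ le))
  decodeForm-codeForm (~ A) (s≤s le) rewrite unpair-pair 2 (codeForm A) =
    cong ~_ (decodeForm-codeForm A le)
  decodeForm-codeForm ([ j ] A) (s≤s le)
    rewrite unpair-pair 3 (pair (toℕ j) (codeForm A)) | unpair-pair (toℕ j) (codeForm A) | finOf-toℕ j
    = cong ([ j ]_) (decodeForm-codeForm A le)
  decodeForm-codeForm (□ A) (s≤s le) rewrite unpair-pair 4 (codeForm A) =
    cong □_ (decodeForm-codeForm A le)
  decodeForm-codeForm (t ∶ A) (s≤s le)
    rewrite unpair-pair 5 (pair (codePol t) (codeForm A)) | unpair-pair (codePol t) (codeForm A)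
    = cong₂ _∶_ (decodePol-codePol t (m⊔n≤o⇒m≤o _ _ le)) (decodeForm-codeForm A (m⊔n≤o⇒n≤o _ _ le))
  decodeForm-codeForm (K A) (s≤s le) rewrite unpair-pair 6 (codeForm A) =
    cong K_ (decodeForm-codeForm A le)
  decodeForm-codeForm (Prove j t A) (s≤s le)
    rewrite unpair-pair 7 (pair (toℕ j) (pair (codePol t) (codeForm A)))
          | unpair-pair (toℕ j) (pair (codePol t) (codeForm A)) | finOf-toℕ j
          | unpair-pair (codePol t) (codeForm A)
    = cong₂ (Prove j) (decodePol-codePol t (m⊔n≤o⇒m≤o _ _ le)) (decodeForm-codeForm A (m⊔n≤o⇒n≤o _ _ le))
  decodeForm-codeForm (Proven t A) (s≤s le)
    rewrite unpair-pair 8 (pair (codePol t) (codeForm A)) | unpair-pair (codePol t) (codeForm A)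
    = cong₂ Proven (decodePol-codePol t (m⊔n≤o⇒m≤o _ _ le)) (decodeForm-codeForm A (m⊔n≤o⇒n≤o _ _ le))

  -- An enumeration of all formulas: the index k codes (fuel, code).
  enumForm : ℕ → Form n
  enumForm = split₂ decodeForm

  enumForm-onto : ∀ A → ∃ λ k → enumForm k ≡ A
  enumForm-onto A = pair (depth A) (codeForm A) , enumerated
    where
    enumerated : enumForm (pair (depth A) (codeForm A)) ≡ A
    enumerated rewrite unpair-pair (depth A) (codeForm A) = decodeForm-codeForm A ≤-refl

-- A record (rather
-- than eval v A ≡ true itself) keeps v and A inferable from the type.
module _ {n : ℕ} where

  record _⊨_ (v : Form n → Bool) (A : Form n) : Set where
    constructor holds
    field evaluates : eval v A ≡ true

  infix 3 _⊨_

  module _ {v : Form n → Bool} where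

    ⊨~⁺ : ∀ {A} → ¬ (v ⊨ A) → v ⊨ ~ A
    ⊨~⁺ h = holds (sym (¬-not (λ e → h (holds (sym e)))))

    ⊨~⁻ : ∀ {A} → v ⊨ ~ A → ¬ (v ⊨ A)
    ⊨~⁻ (holds h) (holds t) = not-¬ (sym t) (sym h)

    ⊨-stable : ∀ {A} → ¬ (v ⊨ ~ A) → v ⊨ A
    ⊨-stable {A} h = holds (stable (eval v A) (λ e → h (holds e)))
      where
      stable : ∀ b → ¬ (not b ≡ true) → b ≡ true
      stable true  _ = refl
      stable false k = ⊥-elim (k refl)

    ⊨&⁺ : ∀ {A B} → v ⊨ A → v ⊨ B → v ⊨ A & B
    ⊨&⁺ (holds a) (holds b) = holds (cong₂ _∧_ a b)

    ⊨&⁻ : ∀ {A B} → v ⊨ A & B → v ⊨ A × v ⊨ B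
    ⊨&⁻ {A} {B} (holds h) = holds (proj₁ (unzip (eval v A) (eval v B) h)) ,
                            holds (proj₂ (unzip (eval v A) (eval v B) h))
      where
      unzip : ∀ a b → a ∧ b ≡ true → a ≡ true × b ≡ true
      unzip true true _ = refl , refl

    ⊨⇒⁺ : ∀ {A B} → (v ⊨ A → v ⊨ B) → v ⊨ A ⇒ B
    ⊨⇒⁺ f = ⊨~⁺ (λ t → let a , nb = ⊨&⁻ t in ⊨~⁻ nb (f a))

    ⊨⇒⁻ : ∀ {A B} → v ⊨ A ⇒ B → v ⊨ A → v ⊨ B
    ⊨⇒⁻ h a = ⊨-stable (λ nb → ⊨~⁻ h (⊨&⁺ a nb))

    ⊨⊤ : v ⊨ ⊤'
    ⊨⊤ = ⊨~⁺ (λ t → let a , na = ⊨&⁻ t in ⊨~⁻ na a)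

    ⊨⋀⁺ : ∀ {L} → All (v ⊨_) L → v ⊨ ⋀ L
    ⊨⋀⁺ []               = ⊨⊤
    ⊨⋀⁺ (a ∷ [])         = a
    ⊨⋀⁺ (a ∷ as@(_ ∷ _)) = ⊨&⁺ a (⊨⋀⁺ as)

    ⊨⋀⁻ : ∀ L → v ⊨ ⋀ L → All (v ⊨_) L
    ⊨⋀⁻ []          _ = []
    ⊨⋀⁻ (_ ∷ [])    t = t ∷ []
    ⊨⋀⁻ (_ ∷ B ∷ L) t = let a , as = ⊨&⁻ t in a ∷ ⊨⋀⁻ (B ∷ L) as

    ⊨⋀-++ : ∀ L {G} → v ⊨ ⋀ (L ++ G) → v ⊨ ⋀ L × v ⊨ ⋀ G
    ⊨⋀-++ L t = let as = ⊨⋀⁻ (L ++ _) t in ⊨⋀⁺ (++⁻ˡ L as) , ⊨⋀⁺ (++⁻ʳ L as)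

module Hilbert {n : ℕ} (CS : Form n → Set) where

  ⊢-taut : ∀ {A} → (∀ v → v ⊨ A) → CS ⊢ A
  ⊢-taut f = ax (A0 (λ v → _⊨_.evaluates (f v)))

  ⊢-by : ∀ {A B} → CS ⊢ A → (∀ v → v ⊨ A → v ⊨ B) → CS ⊢ B
  ⊢-by d f = mp (⊢-taut (λ v → ⊨⇒⁺ (f v))) d

  ⊢-by₂ : ∀ {A B C} → CS ⊢ A → CS ⊢ B → (∀ v → v ⊨ A → v ⊨ B → v ⊨ C) → CS ⊢ C
  ⊢-by₂ d e f = mp (⊢-by d (λ v a → ⊨⇒⁺ (f v a))) e

  ⇒-trans : ∀ {A B C} → CS ⊢ A ⇒ B → CS ⊢ B ⇒ C → CS ⊢ A ⇒ C
  ⇒-trans d e = ⊢-by₂ d e (λ v ab bc → ⊨⇒⁺ (λ a → ⊨⇒⁻ bc (⊨⇒⁻ ab a)))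

  ¬¬-elim : ∀ {A} → CS ⊢ ~ ~ A ⇒ A
  ¬¬-elim = ⊢-taut (λ v → ⊨⇒⁺ (λ nna → ⊨-stable (⊨~⁻ nna)))

  ¬¬-intro : ∀ {A} → CS ⊢ A ⇒ ~ ~ A
  ¬¬-intro = ⊢-taut (λ v → ⊨⇒⁺ (λ a → ⊨~⁺ (λ na → ⊨~⁻ na a)))

  -- Π has no □-necessitation rule; it is derived from K-necessitation
  -- through A8 (KA → □K□A), T for □ and T for K.
  □-nec : ∀ {A} → CS ⊢ A → CS ⊢ □ A
  □-nec d = mp (ax A7-T) (mp (ax A1-□T) (mp (ax A8) (nec d)))

  □-mono : ∀ {A B} → CS ⊢ A ⇒ B → CS ⊢ □ A ⇒ □ B
  □-mono d = mp (ax A1-□K) (□-nec d)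

  □-& : ∀ {A B} → CS ⊢ □ A & □ B ⇒ □ (A & B)
  □-& = ⊢-by₂ (□-mono (⊢-taut (λ v → ⊨⇒⁺ (λ a → ⊨⇒⁺ (λ b → ⊨&⁺ a b))))) (ax A1-□K)
          (λ v pair-up distribute → ⊨⇒⁺ (λ ab → let a , b = ⊨&⁻ ab in
             ⊨⇒⁻ (⊨⇒⁻ distribute (⊨⇒⁻ pair-up a)) b))

  □-⋀ : ∀ Bs → CS ⊢ ⋀ (map □_ Bs) ⇒ □ ⋀ Bs
  □-⋀ []           = ⊢-by (□-nec (⊢-taut (λ v → ⊨⊤))) (λ v b → ⊨⇒⁺ (λ _ → b))
  □-⋀ (B ∷ [])     = ⊢-taut (λ v → ⊨⇒⁺ id)
  □-⋀ (B ∷ C ∷ Bs) = ⊢-by₂ (□-⋀ (C ∷ Bs)) □-& (λ v ih combine → ⊨⇒⁺ (λ t →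
    let b , rest = ⊨&⁻ t in ⊨⇒⁻ combine (⊨&⁺ b (⊨⇒⁻ ih rest))))

  ¬□⇒◇¬ : ∀ {A} → CS ⊢ ~ □ A ⇒ ◇ ~ A
  ¬□⇒◇¬ = ⊢-by (□-mono ¬¬-elim)
    (λ v mono → ⊨⇒⁺ (λ nb → ⊨~⁺ (λ bnn → ⊨~⁻ nb (⊨⇒⁻ mono bnn))))

  ¬⇒◇¬ : ∀ {A} → CS ⊢ ~ A ⇒ ◇ ~ A
  ¬⇒◇¬ = ⊢-by (ax A1-□T) (λ v t → ⊨⇒⁺ (λ na → ⊨~⁺ (λ bnn → ⊨~⁻ (⊨⇒⁻ t bnn) na)))

  -- Knowledge and "proven" facts are □-stable: this is what lets the last
  -- set of an element be exchanged for an accessible one.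
  K⇒□ : ∀ {A} → CS ⊢ K A ⇒ □ A
  K⇒□ = ⇒-trans (ax A8) (⇒-trans (ax A1-□T) (ax A7-T))

  K⇒□K : ∀ {A} → CS ⊢ K A ⇒ □ K A
  K⇒□K = ⇒-trans (ax A7-4) K⇒□

  Proven⇒□Proven : ∀ {t A} → CS ⊢ Proven t A ⇒ □ Proven t A
  Proven⇒□Proven = ⇒-trans (⊢-by (ax B11) (λ v b11 → ⊨⇒⁺ (λ p → proj₁ (⊨&⁻ (⊨⇒⁻ b11 p))))) K⇒□

  Inconsistent : (Form n → Set) → Set
  Inconsistent Γ = Σ (List (Form n)) λ L → All Γ L × (CS ⊢ ~ ⋀ L)

  refute : ∀ {Γ C} → Inconsistent (Γ ∪｛ C ｝) →
           Σ (List (Form n)) λ G → All Γ G × (CS ⊢ ⋀ G ⇒ ~ C)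
  refute {Γ} {C} (L , inL , d) =
    let G , inG , restore = drop C L inL in
    G , inG , ⊢-by d (λ v ¬L → ⊨⇒⁺ (λ g → ⊨~⁺ (λ c →
                ⊨~⁻ ¬L (⊨⋀⁺ (restore v (⊨⋀⁻ G g) c)))))
    where
    drop : ∀ C L → All (Γ ∪｛ C ｝) L →
           Σ (List (Form n)) λ G → All Γ G × (∀ v → All (v ⊨_) G → v ⊨ C → All (v ⊨_) L)
    drop C []      []             = [] , [] , λ _ _ _ → []
    drop C (A ∷ L) (inj₁ a ∷ inL) =
      let G , inG , restore = drop C L inL in
      A ∷ G , a ∷ inG , λ { v (a ∷ g) c → a ∷ restore v g c }
    drop C (A ∷ L) (inj₂ refl ∷ inL) =
      let G , inG , restore = drop C L inL in
      G , inG , λ v g c → c ∷ restore v g c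

  module MCS {Γ : Form n → Set} (mΓ : Maxiconsistent CS Γ) where

    closed : ∀ {L C} → All Γ L → CS ⊢ ⋀ L ⇒ C → Γ C
    closed {L} {C} inL d = proj₂ mΓ C λ inc →
      let G , inG , e = refute inc in
      proj₁ mΓ (L ++ G , ++⁺ inL inG , ⊢-by₂ d e (λ v l⇒c g⇒¬c → ⊨~⁺ (λ t →
        let l , g = ⊨⋀-++ L t in ⊨~⁻ (⊨⇒⁻ g⇒¬c g) (⊨⇒⁻ l⇒c l))))

    closed₁ : ∀ {A C} → Γ A → CS ⊢ A ⇒ C → Γ C
    closed₁ a = closed (a ∷ [])

    not-both : ∀ {A} → Γ A → Γ (~ A) → ⊥
    not-both a na = proj₁ mΓ (_ ∷ _ ∷ [] , a ∷ na ∷ [] ,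
      ⊢-taut (λ v → ⊨~⁺ (λ t → let a , na = ⊨&⁻ t in ⊨~⁻ na a)))

    by-contradiction : ∀ {A} → (Γ (~ A) → ⊥) → Γ A
    by-contradiction {A} h = proj₂ mΓ A λ inc →
      let G , inG , d = refute inc in h (closed inG d)

module Lindenbaum {n : ℕ} (CS : Form n → Set)
                  (enum : ℕ → Form n) (enum-onto : ∀ A → ∃ λ k → enum k ≡ A)
                  (S : Form n → Set) (cS : Consistent CS S) where

  stage : ℕ → Form n → Set
  stage zero      = S
  stage (suc k) B = stage k B ⊎ (B ≡ enum k × Consistent CS (stage k ∪｛ B ｝))

  limit : Form n → Set
  limit B = ∃ λ k → stage k B

  stage-mono : ∀ {k j B} → k ≤′ j → stage k B → stage j B
  stage-mono ≤′-refl      b = b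
  stage-mono (≤′-step le) b = inj₁ (stage-mono le b)

  common-stage : ∀ {L} → All limit L → ∃ λ k → All (stage k) L
  common-stage []              = 0 , []
  common-stage ((k , b) ∷ inL) =
    let j , inj = common-stage inL in
    k ⊔ j , stage-mono (≤⇒≤′ (m≤m⊔n k j)) b ∷ All.map (stage-mono (≤⇒≤′ (m≤n⊔m k j))) inj

  stage-step : ∀ {k L} → All (stage (suc k)) L →
    All (stage k) L ⊎ (Consistent CS (stage k ∪｛ enum k ｝) × All (stage k ∪｛ enum k ｝) L)
  stage-step [] = inj₁ []
  stage-step (inj₁ b ∷ inL) with stage-step inL
  ... | inj₁ old       = inj₁ (b ∷ old)
  ... | inj₂ (c , new) = inj₂ (c , inj₁ b ∷ new)
  stage-step {k} (inj₂ (refl , c) ∷ inL) = inj₂ (c , inj₂ refl ∷ All.map widen inL)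
    where
    widen : ∀ {B} → stage (suc k) B → (stage k ∪｛ enum k ｝) B
    widen (inj₁ b)       = inj₁ b
    widen (inj₂ (e , _)) = inj₂ e

  stage-consistent : ∀ k → Consistent CS (stage k)
  stage-consistent zero = cS
  stage-consistent (suc k) (L , inL , d) with stage-step inL
  ... | inj₁ old       = stage-consistent k (L , old , d)
  ... | inj₂ (c , new) = c (L , new , d)

  limit-maxiconsistent : Maxiconsistent CS limit
  limit-maxiconsistent = consistent , maximal
    where
    consistent : Consistent CS limit
    consistent (L , inL , d) = let k , ink = common-stage inL in stage-consistent k (L , ink , d)

    -- B = enum k was added at stage k+1, since consistency is inherited downwards
    maximal : ∀ B → Consistent CS (limit ∪｛ B ｝) → limit B
    maximal B c with enum-onto B
    ... | k , refl = suc k , inj₂ (refl , λ (L , inL , d) → c (L , All.map lift inL , d))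
      where
      lift : ∀ {A} → (stage k ∪｛ enum k ｝) A → (limit ∪｛ enum k ｝) A
      lift (inj₁ a) = inj₁ (k , a)
      lift (inj₂ e) = inj₂ e

module Canonical {n : ℕ} (CS : Form n → Set) where
  open Hilbert CS

  lindenbaum : ∀ {S} → Consistent CS S →
               Σ (Form n → Set) λ Δ → Maxiconsistent CS Δ × (∀ {B} → S B → Δ B)
  lindenbaum {S} cS = limit , limit-maxiconsistent , λ b → 0 , b
    where open Lindenbaum CS enumForm enumForm-onto S cS

  Sees : (Form n → Set) → (Form n → Set) → Set
  Sees Γ Δ = ∀ C → Γ (□ C) → Δ C

  sees-refl : ∀ {Γ} → Maxiconsistent CS Γ → Sees Γ Γ
  sees-refl mΓ C b = MCS.closed₁ mΓ b (ax A1-□T)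

  -- By T and 5: ¬B ∈ Γ gives □◇¬B ∈ Γ, so ◇¬B ∈ Δ, contradicting □B ∈ Δ.
  sees-sym : ∀ {Γ Δ} → Maxiconsistent CS Γ → Maxiconsistent CS Δ → Sees Γ Δ → Sees Δ Γ
  sees-sym mΓ mΔ Γ⟶Δ B b = MCS.by-contradiction mΓ λ nb →
    let ◇nb = MCS.closed₁ mΓ nb ¬⇒◇¬ in
    MCS.not-both mΔ (MCS.closed₁ mΔ b (□-mono ¬¬-intro))
      (Γ⟶Δ _ (MCS.closed₁ mΓ ◇nb (ax A1-□5)))

  -- By 5 and symmetry: ¬□A ∈ Δ gives □◇¬A ∈ Δ, so ◇¬A ∈ Γ, contradicting □A ∈ Γ.
  □-persists : ∀ {Γ Δ A} → Maxiconsistent CS Γ → Maxiconsistent CS Δ → Sees Γ Δ →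
               Γ (□ A) → Δ (□ A)
  □-persists mΓ mΔ Γ⟶Δ b = MCS.by-contradiction mΔ λ nb →
    let ◇na = MCS.closed₁ mΔ nb ¬□⇒◇¬ in
    MCS.not-both mΓ (MCS.closed₁ mΓ b (□-mono ¬¬-intro))
      (sees-sym mΓ mΔ Γ⟶Δ _ (MCS.closed₁ mΔ ◇na (ax A1-□5)))

  stable-persists : ∀ {Γ Δ X} → Maxiconsistent CS Γ → CS ⊢ X ⇒ □ X →
                    Sees Γ Δ → Γ X → Δ X
  stable-persists mΓ stable Γ⟶Δ x = Γ⟶Δ _ (MCS.closed₁ mΓ x stable)

  -- Existence lemma: if □A ∉ Γ, some accessible maxiconsistent set refutes A,
  -- namely a Lindenbaum extension of {B | □B ∈ Γ} ∪ {¬A}.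
  witness : ∀ {Γ A} → Maxiconsistent CS Γ → Γ (~ □ A) →
            Σ (Form n → Set) λ Δ → Maxiconsistent CS Δ × Sees Γ Δ × Δ (~ A)
  witness {Γ} {A} mΓ n□a =
    let Δ , mΔ , S⊆Δ = lindenbaum consistent in
    Δ , mΔ , (λ C b → S⊆Δ (inj₁ b)) , S⊆Δ (inj₂ refl)
    where
    consistent : Consistent CS ((λ B → Γ (□ B)) ∪｛ ~ A ｝)
    consistent inc =
      let G , inG , d = refute inc in
      MCS.not-both mΓ (MCS.closed mΓ (map⁺ inG) (⇒-trans (□-⋀ G) (□-mono (⇒-trans d ¬¬-elim))))
        n□a

data Position {m : ℕ} (i : Fin (suc m)) : Set where
  last  : i ≡ fromℕ m → Position i
  inner : (k : Fin m) → i ≡ inject₁ k → Position i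

position : ∀ {m} (i : Fin (suc m)) → Position i
position {zero}  zero    = last refl
position {suc m} zero    = inner zero refl
position {suc m} (suc i) with position i
... | last e    = last (cong suc e)
... | inner k e = inner (suc k) (cong suc e)

lastOr : ∀ {m} {A : Set₁} {i : Fin (suc m)} → Position i → A → A → A
lastOr (last _)    a _ = a
lastOr (inner _ _) _ b = b

-- The conditions K-up and P-up
-- at the last step hold because K- and Proven-formulas are □-stable.
module ReplaceEnd {n : ℕ} {CS : Form n → Set} {m : ℕ} (ξ : Element CS m)
                  (Δ : Form n → Set) (mΔ : Maxiconsistent CS Δ)
                  (ξ⟶Δ : Canonical.Sees CS (end ξ) Δ) where
  open Canonical CS
  open Element ξ

  seq′ : Fin (suc m) → Form n → Set
  seq′ i = lastOr (position i) Δ (seq i)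

  seq′-end : seq′ (fromℕ m) ≡ Δ
  seq′-end with position (fromℕ m)
  ... | last _    = refl
  ... | inner _ e = ⊥-elim (fromℕ≢inject₁ e)

  seq′-inner : ∀ k → seq′ (inject₁ k) ≡ seq (inject₁ k)
  seq′-inner k with position (inject₁ k)
  ... | last e    = ⊥-elim (fromℕ≢inject₁ (sym e))
  ... | inner _ _ = refl

  mcs′ : ∀ i → Maxiconsistent CS (seq′ i)
  mcs′ i with position i
  ... | last _    = mΔ
  ... | inner _ _ = mcs i

  inherit : ∀ {X} → CS ⊢ X ⇒ □ X → ∀ i → seq i X → seq′ i X
  inherit stable i x with position i
  ... | last refl = stable-persists (mcs (fromℕ m)) stable ξ⟶Δ x
  ... | inner _ _ = x

  restrict : ∀ {X} k → seq′ (inject₁ k) X → seq (inject₁ k) X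
  restrict {X} k = subst (λ Γ → Γ X) (seq′-inner k)

  τ : Element CS m
  τ = record
    { seq  = seq′
    ; mcs  = mcs′
    ; K-up = λ k B h → inherit (Hilbert.K⇒□K CS) (suc k) (K-up k B (restrict k h))
    ; P-up = λ k j t B h →
               inherit (Hilbert.Proven⇒□Proven CS) (suc k) (P-up k j t B (restrict k h))
    }

  τ-end : ∀ {B} → end τ B → Δ B
  τ-end {B} = subst (λ Γ → Γ B) seq′-end

  τ≡ξ : τ ≡ₑ ξ
  τ≡ξ = (λ k B → mk⇔ (restrict k) (subst (λ Γ → Γ B) (sym (seq′-inner k)))) ,
        (λ C b → sees-sym (mcs (fromℕ m)) mΔ ξ⟶Δ C (τ-end b))

module Intersection {n : ℕ} {CS : Form n → Set} {m : ℕ} (ξ : Element CS m) where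
  open Hilbert CS using (module MCS)
  open Canonical CS

  mΓ : Maxiconsistent CS (end ξ)
  mΓ = Element.mcs ξ (fromℕ m)

  ⋂end⇒end : ∀ {B} → ⋂end ξ B → end ξ B
  ⋂end⇒end h = h ξ ((λ _ _ → mk⇔ id id) , sees-refl mΓ)

  □⇒⋂end : ∀ {A} → end ξ (□ A) → ⋂end ξ A
  □⇒⋂end b τ (_ , τ⟶ξ) = sees-sym (Element.mcs τ (fromℕ m)) mΓ τ⟶ξ _ b

  □⇒⋂end□ : ∀ {A} → end ξ (□ A) → ⋂end ξ (□ A)
  □⇒⋂end□ b τ (_ , τ⟶ξ) =
    let mτ = Element.mcs τ (fromℕ m) in
    □-persists mΓ mτ (sees-sym mτ mΓ τ⟶ξ) b

  -- The existence lemma plus end replacement give a τ ≡ ξ with A ∉ end τ.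
  ⋂end⇒□ : ∀ {A} → ⋂end ξ A → end ξ (□ A)
  ⋂end⇒□ h = MCS.by-contradiction mΓ λ n□a →
    let Δ , mΔ , ξ⟶Δ , na = witness mΓ n□a
        open ReplaceEnd ξ Δ mΔ ξ⟶Δ
    in MCS.not-both mΔ (τ-end (h τ τ≡ξ)) na

lemma7 : {n : ℕ} (CS : Form n → Set) → IsCS CS →
         {m : ℕ} (ξ : Element CS m) (A : Form n) →
         ((⋂end ξ A ⇔ end ξ (□ A)) × (end ξ (□ A) ⇔ ⋂end ξ (□ A))) ×
         (CS ⊢ (A ⇒ □ A) →
           (end ξ A ⇔ ⋂end ξ A) × (⋂end ξ A ⇔ ⋂end ξ (□ A)))
lemma7 CS _ ξ A =
  (mk⇔ ⋂end⇒□ □⇒⋂end , mk⇔ □⇒⋂end□ ⋂end⇒end) ,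
  λ stable → mk⇔ (λ a → □⇒⋂end (Hilbert.MCS.closed₁ CS mΓ a stable)) ⋂end⇒end ,
             mk⇔ (λ h → □⇒⋂end□ (⋂end⇒□ h)) (λ h → □⇒⋂end (⋂end⇒end h))
  where open Intersection ξ
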